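{- Let $q$ be a prime power, $n\ge1$ and $\pi\in S_n$. The double coset $\mathbb{U}_\pi[\pi]\mathbb{B}^+$ of $GL_n(\mathbb{F}_q)$ contains an odd coset (a left coset $\tilde A\mathbb{B}^+$, with $\tilde A=u[\pi]$, $u\in\mathbb{U}_\pi$, all of whose elements are odd matrices) if and only if $\pi(n)=n$.
   Context: $\mathbb{B}^+$ is the group of invertible upper triangular $n\times n$ matrices over $\mathbb{F}_q$, and $\mathbb{U}^-$ is the group of lower triangular $n\times n$ matrices over $\mathbb{F}_q$ with $1$'s on the diagonal. A permutation $\pi\in S_n$ is identified with the matrix $[\pi]$ with $[\pi]_{i,j}=1$ if $i=\pi(j)$ and $0$ otherwise, and $\mathbb{U}_\pi=\mathbb{U}^-\cap([\pi]\mathbb{U}^-[\pi]^{ -1})$; the double coset $\mathbb{U}_\pi[\pi]\mathbb{B}^+$ is the disjoint union of the left cosets $u[\pi]\mathbb{B}^+$, $u\in\mathbb{U}_\pi$. A matrix (or column) over $\mathbb{F}_q$ is called odd if the sum of its entries, computed in $\mathbb{F}_q$, is nonzero, and even otherwise. -}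

module Defs where

open import Level using (Level; _⊔_)
open import Data.Nat using (ℕ; _^_; _≥_)
open import Data.Nat.Primality using (Prime)
open import Data.Fin using (Fin; _<_; _≟_)
open import Data.Fin.Permutation using (Permutation′; _⟨$⟩ʳ_; _⟨$⟩ˡ_)
open import Data.Product using (Σ; ∃; _×_; _,_)
open import Relation.Nullary using (¬_; yes; no)
open import Relation.Binary.PropositionalEquality using (_≡_)
open import Algebra.Bundles using (CommutativeRing)

IsPrimePower : ℕ → Set
IsPrimePower q = Σ ℕ λ p → Σ ℕ λ k → Prime p × k ≥ 1 × q ≡ p ^ k

record FiniteField (c ℓ : Level) (q : ℕ) : Set (Level.suc (c ⊔ ℓ)) where
  field
    commRing : CommutativeRing c ℓ
  open CommutativeRing commRing public
  field
    1≉0     : ¬ (1# ≈ 0#)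
    inverse : ∀ x → ¬ (x ≈ 0#) → Σ Carrier λ y → x * y ≈ 1#
    enum    : Fin q → Carrier
    enum-injective  : ∀ i j → enum i ≈ enum j → i ≡ j
    enum-surjective : ∀ x → Σ (Fin q) λ i → enum i ≈ x

module Matrices {c ℓ : Level} {q : ℕ} (F : FiniteField c ℓ q) where
  open FiniteField F using (Carrier; _≈_; _+_; _*_; 0#; 1#)

  Matrix : ℕ → Set c
  Matrix n = Fin n → Fin n → Carrier

  ∑ : ∀ {n} → (Fin n → Carrier) → Carrier
  ∑ {ℕ.zero}  f = 0#
  ∑ {ℕ.suc n} f = f Fin.zero + ∑ (λ i → f (Fin.suc i))

  _⊗_ : ∀ {n} → Matrix n → Matrix n → Matrix n
  (A ⊗ B) i j = ∑ (λ k → A i k * B k j)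

  I : ∀ {n} → Matrix n
  I i j with i ≟ j
  ... | yes _ = 1#
  ... | no  _ = 0#

  _≋_ : ∀ {n} → Matrix n → Matrix n → Set ℓ
  A ≋ B = ∀ i j → A i j ≈ B i j

  Invertible : ∀ {n} → Matrix n → Set (c ⊔ ℓ)
  Invertible {n} A = Σ (Matrix n) λ B → (A ⊗ B) ≋ I × (B ⊗ A) ≋ I

  InB⁺ : ∀ {n} → Matrix n → Set (c ⊔ ℓ)
  InB⁺ A = (∀ i j → j < i → A i j ≈ 0#) × Invertible A

  InU⁻ : ∀ {n} → Matrix n → Set ℓ
  InU⁻ A = (∀ i j → i < j → A i j ≈ 0#) × (∀ i → A i i ≈ 1#)

  [_] : ∀ {n} → Permutation′ n → Matrix n
  [ π ] i j with i ≟ (π ⟨$⟩ʳ j)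
  ... | yes _ = 1#
  ... | no  _ = 0#

  -- 𝕌_π = 𝕌⁻ ∩ [π] 𝕌⁻ [π]⁻¹
  InUπ : ∀ {n} → Permutation′ n → Matrix n → Set (c ⊔ ℓ)
  InUπ {n} π u = InU⁻ u ×
    Σ (Matrix n) λ v → InU⁻ v × Σ (Matrix n) λ πinv →
      ([ π ] ⊗ πinv) ≋ I × (πinv ⊗ [ π ]) ≋ I × u ≋ (([ π ] ⊗ v) ⊗ πinv)

  Odd : ∀ {n} → Matrix n → Set ℓ
  Odd A = ¬ (∑ (λ i → ∑ (λ j → A i j)) ≈ 0#)

  OddCoset : ∀ {n} → Permutation′ n → Matrix n → Set (c ⊔ ℓ)
  OddCoset π u = ∀ b → InB⁺ b → Odd ((u ⊗ [ π ]) ⊗ b)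

  HasOddCoset : ∀ {n} → Permutation′ n → Set (c ⊔ ℓ)
  HasOddCoset {n} π = Σ (Matrix n) λ u → InUπ π u × OddCoset π u

{-# OPTIONS --safe #-}
-- The entry sum of A B is ∑ₖ (column sum k of A) (row sum k of B), and for u ∈ 𝕌⁻ the
-- column of u[π] with index p = π⁻¹(n) sums to 1. If p ≠ n, the transvection
-- I + x e_p e_nᵀ lies in 𝔹⁺ and shifts the entry sum of u[π] by x, so x = −(entry sum)
-- makes it even: no coset is odd. If p = n, take u = I + e_n (e_n − 𝟙)ᵀ, which commutes
-- with [π] and has column sums e_nᵀ; the entry sum of u[π]b is then b_nn ≠ 0.
module Submission where

open import Defs
open import Level using (Level)
open import Data.Nat using (ℕ; suc)
open import Data.Fin using (fromℕ)
open import Data.Fin.Permutation using (Permutation′; _⟨$⟩ʳ_)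
open import Relation.Binary.PropositionalEquality using (_≡_)
open import Function.Bundles using (_⇔_)

open import Algebra.Bundles using (CommutativeMonoid)
open import Data.Empty using (⊥-elim)
open import Data.Fin using (Fin; zero; suc; punchIn; _<_; _≟_)
open import Data.Fin.Permutation using (_⟨$⟩ˡ_; flip; inverseˡ; inverseʳ)
open import Data.Fin.Properties using (punchInᵢ≢i; ≤fromℕ; ≤∧≢⇒<; <⇒≢; <-trans)
open import Data.Nat.Properties using (<⇒≱)
open import Data.Product using (_,_)
open import Data.Vec.Functional using (Vector)
open import Function using (_∘_)
open import Function.Bundles using (Injection; mk⇔)
open import Function.Definitions using (Injective)
open import Function.Properties.Inverse using (↔⇒↣)
open import Relation.Binary.PropositionalEquality as P using (_≢_)
open import Relation.Nullary using (¬_; Dec; yes; no)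
open import Relation.Nullary.Decidable using (decidable-stable)

module CommutativeMonoidSum {a ℓ} (M : CommutativeMonoid a ℓ) where
  open CommutativeMonoid M
    renaming (_∙_ to _+_; ε to 0#; ∙-congˡ to +-congˡ; identityʳ to +-identityʳ)
  open import Algebra.Properties.CommutativeMonoid.Sum M

  sum-single : ∀ {n} {f : Vector Carrier n} (k : Fin n) →
               (∀ i → i ≢ k → f i ≈ 0#) → sum f ≈ f k
  sum-single {suc n} {f} k vanish = begin
    sum f                       ≈⟨ sum-remove f ⟩
    f k + sum (f ∘ punchIn k)   ≈⟨ +-congˡ (sum-cong-≋ λ j → vanish _ (punchInᵢ≢i k j)) ⟩
    f k + sum {n} (λ _ → 0#)    ≈⟨ +-congˡ (sum-replicate-zero n) ⟩
    f k + 0#                    ≈⟨ +-identityʳ (f k) ⟩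
    f k                         ∎
    where open import Relation.Binary.Reasoning.Setoid setoid

⟨$⟩ʳ-injective : ∀ {n} (σ : Permutation′ n) → Injective _≡_ _≡_ (σ ⟨$⟩ʳ_)
⟨$⟩ʳ-injective σ = Injection.injective (↔⇒↣ σ)

⟨$⟩ˡ-injective : ∀ {n} (σ : Permutation′ n) → Injective _≡_ _≡_ (σ ⟨$⟩ˡ_)
⟨$⟩ˡ-injective σ = ⟨$⟩ʳ-injective (flip σ)

≢fromℕ⇒< : ∀ {m} {i : Fin (suc m)} → i ≢ fromℕ m → i < fromℕ m
≢fromℕ⇒< {i = i} i≢last = ≤∧≢⇒< (≤fromℕ i) i≢last

fromℕ≮ : ∀ {m} (i : Fin (suc m)) → ¬ (fromℕ m < i)
fromℕ≮ i last<i = <⇒≱ last<i (≤fromℕ i)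

module _ {c ℓ : Level} {q : ℕ} (F : FiniteField c ℓ q) where
  open FiniteField F hiding (zero)
  open Matrices F
  open import Algebra.Properties.Semiring.Sum semiring
    using (sum; sum-cong-≋; sum-cong-≗; ∑-comm; ∑-distrib-+; *-distribˡ-sum; *-distribʳ-sum)
  open import Algebra.Properties.AbelianGroup +-abelianGroup using (xyx⁻¹≈y)
  open CommutativeMonoidSum +-commutativeMonoid using (sum-single)
  open import Relation.Binary.Reasoning.Setoid setoid

  ∑≡sum : ∀ {n} (f : Fin n → Carrier) → ∑ f ≡ sum f
  ∑≡sum {ℕ.zero} f = P.refl
  ∑≡sum {suc n}  f = P.cong (f zero +_) (∑≡sum (f ∘ suc))

  I-diag : ∀ {n} (i : Fin n) → I i i ≈ 1#
  I-diag i with i ≟ i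
  ... | yes _ = refl
  ... | no i≢i = ⊥-elim (i≢i P.refl)

  I-off : ∀ {n} {i j : Fin n} → i ≢ j → I i j ≈ 0#
  I-off {i = i} {j} i≢j with i ≟ j
  ... | yes i≡j = ⊥-elim (i≢j i≡j)
  ... | no _ = refl

  I-relabel : ∀ {n} {g : Fin n → Fin n} → Injective _≡_ _≡_ g →
              ∀ i j → I (g i) (g j) ≡ I i j
  I-relabel {g = g} g-inj i j with g i ≟ g j | i ≟ j
  ... | yes _   | yes _   = P.refl
  ... | no _    | no _    = P.refl
  ... | yes gij | no i≢j  = ⊥-elim (i≢j (g-inj gij))
  ... | no gi≢gj | yes i≡j = ⊥-elim (gi≢gj (P.cong g i≡j))

  sum-I-row : ∀ {n} (i : Fin n) → sum (λ j → I i j) ≈ 1#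
  sum-I-row i = trans (sum-single i λ j j≢i → I-off (j≢i ∘ P.sym)) (I-diag i)

  sum-I-column : ∀ {n} (j : Fin n) → sum (λ i → I i j) ≈ 1#
  sum-I-column j = trans (sum-single j λ i i≢j → I-off i≢j) (I-diag j)

  sum-I-* : ∀ {n} (i : Fin n) (f : Fin n → Carrier) → sum (λ j → I i j * f j) ≈ f i
  sum-I-* i f = trans (sum-single i λ j j≢i → trans (*-congʳ (I-off (j≢i ∘ P.sym))) (zeroˡ (f j)))
                      (trans (*-congʳ (I-diag i)) (*-identityˡ (f i)))

  sum-*-I : ∀ {n} (f : Fin n → Carrier) (j : Fin n) → sum (λ i → f i * I i j) ≈ f j
  sum-*-I f j = trans (sum-single j λ i i≢j → trans (*-congˡ (I-off i≢j)) (zeroʳ (f i)))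
                      (trans (*-congˡ (I-diag j)) (*-identityʳ (f j)))

  []≡Iʳ : ∀ {n} (σ : Permutation′ n) i j → [ σ ] i j ≡ I i (σ ⟨$⟩ʳ j)
  []≡Iʳ σ i j with i ≟ σ ⟨$⟩ʳ j
  ... | yes _ = P.refl
  ... | no _  = P.refl

  []≡Iˡ : ∀ {n} (σ : Permutation′ n) i j → [ σ ] i j ≡ I (σ ⟨$⟩ˡ i) j
  []≡Iˡ σ i j = P.trans ([]≡Iʳ σ i j)
    (P.trans (P.sym (I-relabel (⟨$⟩ˡ-injective σ) i _))
             (P.cong (I (σ ⟨$⟩ˡ i)) (inverseˡ σ)))

  ⊗≡sum : ∀ {n} (A B : Matrix n) i j → (A ⊗ B) i j ≡ sum (λ k → A i k * B k j)
  ⊗≡sum A B i j = ∑≡sum (λ k → A i k * B k j)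

  []-⊗ : ∀ {n} (σ : Permutation′ n) (A : Matrix n) i j → ([ σ ] ⊗ A) i j ≈ A (σ ⟨$⟩ˡ i) j
  []-⊗ σ A i j = begin
    ([ σ ] ⊗ A) i j                          ≡⟨ ⊗≡sum [ σ ] A i j ⟩
    sum (λ k → [ σ ] i k * A k j)            ≡⟨ sum-cong-≗ (λ k → P.cong (_* A k j) ([]≡Iˡ σ i k)) ⟩
    sum (λ k → I (σ ⟨$⟩ˡ i) k * A k j)       ≈⟨ sum-I-* (σ ⟨$⟩ˡ i) (λ k → A k j) ⟩
    A (σ ⟨$⟩ˡ i) j                           ∎

  ⊗-[] : ∀ {n} (σ : Permutation′ n) (A : Matrix n) i j → (A ⊗ [ σ ]) i j ≈ A i (σ ⟨$⟩ʳ j)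
  ⊗-[] σ A i j = begin
    (A ⊗ [ σ ]) i j                          ≡⟨ ⊗≡sum A [ σ ] i j ⟩
    sum (λ k → A i k * [ σ ] k j)            ≡⟨ sum-cong-≗ (λ k → P.cong (A i k *_) ([]≡Iʳ σ k j)) ⟩
    sum (λ k → A i k * I k (σ ⟨$⟩ʳ j))       ≈⟨ sum-*-I (A i) (σ ⟨$⟩ʳ j) ⟩
    A i (σ ⟨$⟩ʳ j)                           ∎

  []-⊗-[flip] : ∀ {n} (σ : Permutation′ n) → ([ σ ] ⊗ [ flip σ ]) ≋ I
  []-⊗-[flip] σ i j = begin
    ([ σ ] ⊗ [ flip σ ]) i j                 ≈⟨ []-⊗ σ [ flip σ ] i j ⟩
    [ flip σ ] (σ ⟨$⟩ˡ i) j                  ≡⟨ []≡Iʳ (flip σ) (σ ⟨$⟩ˡ i) j ⟩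
    I (σ ⟨$⟩ˡ i) (σ ⟨$⟩ˡ j)                  ≡⟨ I-relabel (⟨$⟩ˡ-injective σ) i j ⟩
    I i j                                    ∎

  InUπ-of-invariant : ∀ {n} (σ : Permutation′ n) {u : Matrix n} → InU⁻ u →
                      (∀ i j → u (σ ⟨$⟩ˡ i) (σ ⟨$⟩ˡ j) ≈ u i j) → InUπ σ u
  InUπ-of-invariant σ {u} u∈U⁻ invariant =
    u∈U⁻ , u , u∈U⁻ , [ flip σ ] , []-⊗-[flip] σ , []-⊗-[flip] (flip σ) , conjugate
    where
    conjugate : u ≋ (([ σ ] ⊗ u) ⊗ [ flip σ ])
    conjugate i j = sym (begin
      (([ σ ] ⊗ u) ⊗ [ flip σ ]) i j          ≈⟨ ⊗-[] (flip σ) ([ σ ] ⊗ u) i j ⟩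
      ([ σ ] ⊗ u) i (σ ⟨$⟩ˡ j)                ≈⟨ []-⊗ σ u i (σ ⟨$⟩ˡ j) ⟩
      u (σ ⟨$⟩ˡ i) (σ ⟨$⟩ˡ j)                 ≈⟨ invariant i j ⟩
      u i j                                   ∎)

  rowSum colSum : ∀ {n} → Matrix n → Fin n → Carrier
  rowSum A i = sum (λ j → A i j)
  colSum A j = sum (λ i → A i j)

  -- Stated with Defs' ∑ so that Odd A unfolds to ¬ (total A ≈ 0#).
  total : ∀ {n} → Matrix n → Carrier
  total A = ∑ (λ i → ∑ (λ j → A i j))

  total≡sum-rowSum : ∀ {n} (A : Matrix n) → total A ≡ sum (rowSum A)
  total≡sum-rowSum A = P.trans (∑≡sum (λ i → ∑ (A i))) (sum-cong-≗ λ i → ∑≡sum (A i))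

  sum-colSum : ∀ {n} (A : Matrix n) → sum (colSum A) ≈ total A
  sum-colSum A = trans (sym (∑-comm A)) (reflexive (P.sym (total≡sum-rowSum A)))

  total-⊗ : ∀ {n} (A B : Matrix n) → total (A ⊗ B) ≈ sum (λ k → colSum A k * rowSum B k)
  total-⊗ A B = begin
    total (A ⊗ B)
      ≡⟨ total≡sum-rowSum (A ⊗ B) ⟩
    sum (λ i → sum (λ j → (A ⊗ B) i j))
      ≡⟨ sum-cong-≗ (λ i → sum-cong-≗ (⊗≡sum A B i)) ⟩
    sum (λ i → sum (λ j → sum (λ k → A i k * B k j)))
      ≈⟨ sum-cong-≋ (λ i → ∑-comm (λ j k → A i k * B k j)) ⟩
    sum (λ i → sum (λ k → sum (λ j → A i k * B k j)))
      ≈⟨ ∑-comm (λ i k → sum (λ j → A i k * B k j)) ⟩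
    sum (λ k → sum (λ i → sum (λ j → A i k * B k j)))
      ≈⟨ sum-cong-≋ (λ k → sum-cong-≋ λ i → sym (*-distribˡ-sum (A i k) (B k))) ⟩
    sum (λ k → sum (λ i → A i k * rowSum B k))
      ≈⟨ sum-cong-≋ (λ k → sym (*-distribʳ-sum (rowSum B k) (λ i → A i k))) ⟩
    sum (λ k → colSum A k * rowSum B k)
      ∎

  colSum-⊗-[] : ∀ {n} (σ : Permutation′ n) (A : Matrix n) k →
                colSum (A ⊗ [ σ ]) k ≈ colSum A (σ ⟨$⟩ʳ k)
  colSum-⊗-[] σ A k = sum-cong-≋ λ i → ⊗-[] σ A i k

  colSum-last-U⁻ : ∀ {m} {u : Matrix (suc m)} → InU⁻ u → colSum u (fromℕ m) ≈ 1#
  colSum-last-U⁻ (upper-zero , diagonal) =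
    trans (sum-single _ λ i i≢last → upper-zero i _ (≢fromℕ⇒< i≢last)) (diagonal _)

  rowSum-last-B⁺ : ∀ {m} {b : Matrix (suc m)} → InB⁺ b →
                   rowSum b (fromℕ m) ≈ b (fromℕ m) (fromℕ m)
  rowSum-last-B⁺ (lower-zero , _) = sum-single _ λ j j≢last → lower-zero _ j (≢fromℕ⇒< j≢last)

  B⁺-last-diagonal-nonzero : ∀ {m} {b : Matrix (suc m)} → InB⁺ b →
                             ¬ (b (fromℕ m) (fromℕ m) ≈ 0#)
  B⁺-last-diagonal-nonzero {m} {b} (lower-zero , b′ , b⊗b′≋I , _) bₗₗ≈0 = 1≉0 (begin
    1#                                ≈⟨ I-diag last ⟨
    I last last                       ≈⟨ b⊗b′≋I last last ⟨
    (b ⊗ b′) last last                ≡⟨ ⊗≡sum b b′ last last ⟩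
    sum (λ k → b last k * b′ k last)  ≈⟨ sum-single last bₗₖb′ₖₗ≈0 ⟩
    b last last * b′ last last        ≈⟨ *-congʳ bₗₗ≈0 ⟩
    0# * b′ last last                 ≈⟨ zeroˡ _ ⟩
    0#                                ∎)
    where
    last = fromℕ m
    bₗₖb′ₖₗ≈0 : ∀ k → k ≢ last → b last k * b′ k last ≈ 0#
    bₗₖb′ₖₗ≈0 k k≢last = trans (*-congʳ (lower-zero last k (≢fromℕ⇒< k≢last))) (zeroˡ (b′ k last))

  transvection : ∀ {n} → Fin n → Fin n → Carrier → Matrix n
  transvection k l x i j = I i j + x * I i k * I l j

  transvection-⊗ : ∀ {n} (k l : Fin n) x (B : Matrix n) i j →
                   (transvection k l x ⊗ B) i j ≈ B i j + x * I i k * B l j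
  transvection-⊗ k l x B i j = begin
    (transvection k l x ⊗ B) i j
      ≡⟨ ⊗≡sum (transvection k l x) B i j ⟩
    sum (λ m → (I i m + x * I i k * I l m) * B m j)
      ≈⟨ sum-cong-≋ (λ m → trans (distribʳ (B m j) (I i m) _)
                                 (+-congˡ (*-assoc (x * I i k) (I l m) (B m j)))) ⟩
    sum (λ m → I i m * B m j + x * I i k * (I l m * B m j))
      ≈⟨ ∑-distrib-+ (λ m → I i m * B m j) _ ⟩
    sum (λ m → I i m * B m j) + sum (λ m → x * I i k * (I l m * B m j))
      ≈⟨ +-cong (sum-I-* i (λ m → B m j))
                (sym (*-distribˡ-sum (x * I i k) (λ m → I l m * B m j))) ⟩
    B i j + x * I i k * sum (λ m → I l m * B m j)
      ≈⟨ +-congˡ (*-congˡ (sum-I-* l (λ m → B m j))) ⟩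
    B i j + x * I i k * B l j
      ∎

  transvection-cong : ∀ {n} (k l : Fin n) {x y} → x ≈ y → transvection k l x ≋ transvection k l y
  transvection-cong k l x≈y i j = +-congˡ (*-congʳ (*-congʳ x≈y))

  transvection-zero : ∀ {n} (k l : Fin n) → transvection k l 0# ≋ I
  transvection-zero k l i j =
    trans (+-congˡ (trans (*-congʳ (zeroˡ (I i k))) (zeroˡ (I l j)))) (+-identityʳ (I i j))

  transvection-+ : ∀ {n} {k l : Fin n} → k ≢ l → ∀ x y →
                   (transvection k l x ⊗ transvection k l y) ≋ transvection k l (x + y)
  transvection-+ {k = k} {l} k≢l x y i j = begin
    (transvection k l x ⊗ transvection k l y) i j
      ≈⟨ transvection-⊗ k l x (transvection k l y) i j ⟩
    (I i j + y * I i k * I l j) + x * I i k * (I l j + y * I l k * I l j)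
      ≈⟨ +-congˡ (*-congˡ (trans (+-congˡ yIₗₖIₗⱼ≈0) (+-identityʳ (I l j)))) ⟩
    (I i j + y * I i k * I l j) + x * I i k * I l j
      ≈⟨ +-assoc (I i j) _ _ ⟩
    I i j + (y * I i k * I l j + x * I i k * I l j)
      ≈⟨ +-congˡ (+-comm (y * I i k * I l j) _) ⟩
    I i j + (x * I i k * I l j + y * I i k * I l j)
      ≈⟨ +-congˡ (sym (distribʳ (I l j) (x * I i k) _)) ⟩
    I i j + (x * I i k + y * I i k) * I l j
      ≈⟨ +-congˡ (*-congʳ (sym (distribʳ (I i k) x y))) ⟩
    I i j + (x + y) * I i k * I l j
      ∎
    where
    yIₗₖIₗⱼ≈0 : y * I l k * I l j ≈ 0#
    yIₗₖIₗⱼ≈0 = trans (*-congʳ (trans (*-congˡ (I-off (k≢l ∘ P.sym))) (zeroʳ y))) (zeroˡ (I l j))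

  transvection-invertible : ∀ {n} {k l : Fin n} → k ≢ l → ∀ x → Invertible (transvection k l x)
  transvection-invertible {k = k} {l} k≢l x =
    transvection k l (- x) , cancel x (- x) (-‿inverseʳ x) , cancel (- x) x (-‿inverseˡ x)
    where
    cancel : ∀ x y → x + y ≈ 0# → (transvection k l x ⊗ transvection k l y) ≋ I
    cancel x y x+y≈0 i j = trans (transvection-+ k≢l x y i j)
      (trans (transvection-cong k l x+y≈0 i j) (transvection-zero k l i j))

  transvection∈B⁺ : ∀ {n} {k l : Fin n} → k < l → ∀ x → InB⁺ (transvection k l x)
  transvection∈B⁺ {k = k} {l} k<l x = lower-zero , transvection-invertible (<⇒≢ k<l) x
    where
    xIᵢₖIₗⱼ≈0 : ∀ {i j} → j < i → Dec (i ≡ k) → x * I i k * I l j ≈ 0#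
    xIᵢₖIₗⱼ≈0 j<i (yes P.refl) =
      trans (*-congˡ (I-off λ l≡j → <⇒≢ (<-trans j<i k<l) (P.sym l≡j))) (zeroʳ (x * I k k))
    xIᵢₖIₗⱼ≈0 {j = j} _ (no i≢k) =
      trans (*-congʳ (trans (*-congˡ (I-off i≢k)) (zeroʳ x))) (zeroˡ (I l j))
    lower-zero : ∀ i j → j < i → transvection k l x i j ≈ 0#
    lower-zero i j j<i =
      trans (+-cong (I-off (<⇒≢ j<i ∘ P.sym)) (xIᵢₖIₗⱼ≈0 j<i (i ≟ k))) (+-identityʳ 0#)

  rowSum-transvection : ∀ {n} (k l : Fin n) x i → rowSum (transvection k l x) i ≈ 1# + x * I i k
  rowSum-transvection k l x i = begin
    sum (λ j → I i j + x * I i k * I l j)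
      ≈⟨ ∑-distrib-+ (λ j → I i j) _ ⟩
    sum (λ j → I i j) + sum (λ j → x * I i k * I l j)
      ≈⟨ +-cong (sum-I-row i) (sym (*-distribˡ-sum (x * I i k) (λ j → I l j))) ⟩
    1# + x * I i k * sum (λ j → I l j)
      ≈⟨ +-congˡ (trans (*-congˡ (sum-I-row l)) (*-identityʳ (x * I i k))) ⟩
    1# + x * I i k
      ∎

  total-⊗-transvection : ∀ {n} (A : Matrix n) (k l : Fin n) x →
                         total (A ⊗ transvection k l x) ≈ total A + colSum A k * x
  total-⊗-transvection A k l x = begin
    total (A ⊗ transvection k l x)
      ≈⟨ total-⊗ A (transvection k l x) ⟩
    sum (λ m → colSum A m * rowSum (transvection k l x) m)
      ≈⟨ sum-cong-≋ (λ m → trans (*-congˡ (rowSum-transvection k l x m))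
                                 (distribˡ (colSum A m) 1# _)) ⟩
    sum (λ m → colSum A m * 1# + colSum A m * (x * I m k))
      ≈⟨ ∑-distrib-+ (λ m → colSum A m * 1#) _ ⟩
    sum (λ m → colSum A m * 1#) + sum (λ m → colSum A m * (x * I m k))
      ≈⟨ +-cong (sum-cong-≋ λ m → *-identityʳ (colSum A m))
                (sum-cong-≋ λ m → sym (*-assoc (colSum A m) x (I m k))) ⟩
    sum (colSum A) + sum (λ m → colSum A m * x * I m k)
      ≈⟨ +-cong (sum-colSum A) (sum-*-I (λ m → colSum A m * x) k) ⟩
    total A + colSum A k * x
      ∎

  columnCanceller : ∀ {n} → Fin n → Matrix n
  columnCanceller l i j = I i j + I i l * (I l j - 1#)

  columnCanceller-relabel : ∀ {n} {g : Fin n → Fin n} → Injective _≡_ _≡_ g → ∀ l i j →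
                            columnCanceller (g l) (g i) (g j) ≡ columnCanceller l i j
  columnCanceller-relabel g-inj l i j = P.cong₂ _+_ (I-relabel g-inj i j)
    (P.cong₂ _*_ (I-relabel g-inj i l) (P.cong (_- 1#) (I-relabel g-inj l j)))

  colSum-columnCanceller : ∀ {n} (l k : Fin n) → colSum (columnCanceller l) k ≈ I l k
  colSum-columnCanceller l k = begin
    sum (λ i → I i k + I i l * (I l k - 1#))
      ≈⟨ ∑-distrib-+ (λ i → I i k) _ ⟩
    sum (λ i → I i k) + sum (λ i → I i l * (I l k - 1#))
      ≈⟨ +-cong (sum-I-column k) (sym (*-distribʳ-sum (I l k - 1#) (λ i → I i l))) ⟩
    1# + sum (λ i → I i l) * (I l k - 1#)
      ≈⟨ +-congˡ (trans (*-congʳ (sum-I-column l)) (*-identityˡ (I l k - 1#))) ⟩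
    1# + (I l k - 1#)
      ≈⟨ +-assoc 1# (I l k) (- 1#) ⟨
    1# + I l k - 1#
      ≈⟨ xyx⁻¹≈y 1# (I l k) ⟩
    I l k
      ∎

  columnCanceller-last∈U⁻ : ∀ m → InU⁻ (columnCanceller (fromℕ m))
  columnCanceller-last∈U⁻ m = upper-zero , diagonal
    where
    last = fromℕ m
    upper-zero : ∀ i j → i < j → columnCanceller last i j ≈ 0#
    upper-zero i j i<j =
      trans (+-cong (I-off (<⇒≢ i<j)) (trans (*-congʳ Iᵢₗ≈0) (zeroˡ (I last j - 1#))))
            (+-identityʳ 0#)
      where Iᵢₗ≈0 = I-off λ i≡last → fromℕ≮ j (P.subst (_< j) i≡last i<j)
    off-diagonal-part : ∀ i → Dec (i ≡ last) → I i last * (I last i - 1#) ≈ 0#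
    off-diagonal-part i (yes P.refl) =
      trans (*-congˡ (trans (+-congʳ (I-diag last)) (-‿inverseʳ 1#))) (zeroʳ (I last last))
    off-diagonal-part i (no i≢last) = trans (*-congʳ (I-off i≢last)) (zeroˡ (I last i - 1#))
    diagonal : ∀ i → columnCanceller last i i ≈ 1#
    diagonal i = trans (+-cong (I-diag i) (off-diagonal-part i (i ≟ last))) (+-identityʳ 1#)

  fixed⇒OddCoset : ∀ {m} (π : Permutation′ (suc m)) → π ⟨$⟩ʳ fromℕ m ≡ fromℕ m →
                   OddCoset π (columnCanceller (fromℕ m))
  fixed⇒OddCoset {m} π fixed b b∈B⁺ total≈0 = B⁺-last-diagonal-nonzero b∈B⁺ (begin
    b last last
      ≈⟨ rowSum-last-B⁺ b∈B⁺ ⟨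
    rowSum b last
      ≈⟨ sum-I-* last (rowSum b) ⟨
    sum (λ k → I last k * rowSum b k)
      ≈⟨ sum-cong-≋ (λ k → *-congʳ {rowSum b k} (colSum-u[π] k)) ⟨
    sum (λ k → colSum (u ⊗ [ π ]) k * rowSum b k)
      ≈⟨ total-⊗ (u ⊗ [ π ]) b ⟨
    total ((u ⊗ [ π ]) ⊗ b)
      ≈⟨ total≈0 ⟩
    0#
      ∎)
    where
    last = fromℕ m
    u = columnCanceller last
    colSum-u[π] : ∀ k → colSum (u ⊗ [ π ]) k ≈ I last k
    colSum-u[π] k = begin
      colSum (u ⊗ [ π ]) k        ≈⟨ colSum-⊗-[] π u k ⟩
      colSum u (π ⟨$⟩ʳ k)          ≈⟨ colSum-columnCanceller last (π ⟨$⟩ʳ k) ⟩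
      I last (π ⟨$⟩ʳ k)            ≡⟨ P.cong (λ l → I l (π ⟨$⟩ʳ k)) fixed ⟨
      I (π ⟨$⟩ʳ last) (π ⟨$⟩ʳ k)   ≡⟨ I-relabel (⟨$⟩ʳ-injective π) last k ⟩
      I last k                     ∎

  fixed⇒HasOddCoset : ∀ {m} (π : Permutation′ (suc m)) → π ⟨$⟩ʳ fromℕ m ≡ fromℕ m →
                      HasOddCoset π
  fixed⇒HasOddCoset {m} π fixed =
    u , InUπ-of-invariant π (columnCanceller-last∈U⁻ m) invariant , fixed⇒OddCoset π fixed
    where
    last = fromℕ m
    u = columnCanceller last
    π⁻¹-fixed : π ⟨$⟩ˡ last ≡ last
    π⁻¹-fixed = P.trans (P.cong (π ⟨$⟩ˡ_) (P.sym fixed)) (inverseˡ π)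
    invariant : ∀ i j → u (π ⟨$⟩ˡ i) (π ⟨$⟩ˡ j) ≈ u i j
    invariant i j = reflexive (P.trans
      (P.cong (λ l → columnCanceller l (π ⟨$⟩ˡ i) (π ⟨$⟩ˡ j)) (P.sym π⁻¹-fixed))
      (columnCanceller-relabel (⟨$⟩ˡ-injective π) last i j))

  moved⇒¬OddCoset : ∀ {m} (π : Permutation′ (suc m)) → π ⟨$⟩ʳ fromℕ m ≢ fromℕ m →
                    ∀ {u} → InU⁻ u → ¬ OddCoset π u
  moved⇒¬OddCoset {m} π moved {u} u∈U⁻ odd =
    odd (transvection p last x) (transvection∈B⁺ (≢fromℕ⇒< p≢last) x) (begin
      total (A ⊗ transvection p last x)  ≈⟨ total-⊗-transvection A p last x ⟩
      total A + colSum A p * x           ≈⟨ +-congˡ (trans (*-congʳ colSum-A-p) (*-identityˡ x)) ⟩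
      total A - total A                  ≈⟨ -‿inverseʳ (total A) ⟩
      0#                                 ∎)
    where
    last = fromℕ m
    p = π ⟨$⟩ˡ last
    A = u ⊗ [ π ]
    x = - total A
    p≢last : p ≢ last
    p≢last p≡last = moved (P.trans (P.cong (π ⟨$⟩ʳ_) (P.sym p≡last)) (inverseʳ π))
    colSum-A-p : colSum A p ≈ 1#
    colSum-A-p = trans (colSum-⊗-[] π u p)
      (trans (reflexive (P.cong (colSum u) (inverseʳ π))) (colSum-last-U⁻ u∈U⁻))

lemma3p6 : ∀ {c ℓ : Level} (q : ℕ) → IsPrimePower q → (F : FiniteField c ℓ q) →
    (m : ℕ) (π : Permutation′ (suc m)) →
    Matrices.HasOddCoset F π ⇔ (π ⟨$⟩ʳ fromℕ m ≡ fromℕ m)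
lemma3p6 q _ F m π = mk⇔ hasOddCoset⇒fixed (fixed⇒HasOddCoset F π)
  where
  hasOddCoset⇒fixed : Matrices.HasOddCoset F π → π ⟨$⟩ʳ fromℕ m ≡ fromℕ m
  hasOddCoset⇒fixed (u , (u∈U⁻ , _) , odd) = decidable-stable (π ⟨$⟩ʳ fromℕ m ≟ fromℕ m)
    λ moved → moved⇒¬OddCoset F π moved u∈U⁻ odd
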